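{- Over the calculus QHC (described in the context): (a) The $?^*$-Principle $(?\alpha\to ?\beta)\leftrightarrow ?(\nabla\alpha\to\nabla\beta)$ and the $\forall^*$-Principle $\forall x\,?\alpha(x)\leftrightarrow ?\forall x\,\nabla\alpha(x)$, taken together with the schema $p\leftrightarrow\Box p$ for atomic propositions $p$, are equivalent to the schema $p\leftrightarrow\Box p$ for all propositions $p$. (b) The $\lor^*$-Principle $!p\lor !q\leftrightarrow !(\Box p\lor\Box q)$ and the $\exists^*$-Principle $\exists x\,!p(x)\leftrightarrow !\exists x\,\Box p(x)$, taken together with the schema $\alpha\leftrightarrow\nabla\alpha$ for atomic problems $\alpha$, are equivalent to the schema $\alpha\leftrightarrow\nabla\alpha$ for all problems $\alpha$.
   Context: QHC (the joint logic of problems and propositions) is a two-sorted first-order calculus over a single domain of individuals. Formulas are of two sorts: propositions (letters $p,q$) and problems (letters $\alpha,\beta$). Propositions are built from atomic propositions and from expressions $?\alpha$ ($\alpha$ a problem) by the classical connectives $\land,\lor,\to,\neg$, the constant $0$ (falsity) and quantifiers $\forall x,\exists x$. Problems are built from atomic problems and from expressions $!p$ ($p$ a proposition) by the intuitionistic connectives $\land,\lor,\to,\neg$, the constant $\bot$ and quantifiers $\forall x,\exists x$. Derivability in QHC: all axioms and rules of classical predicate logic apply to propositions, all axioms and rules of intuitionistic predicate logic apply to problems, and in addition there are the inference rules "from $\alpha$ infer $?\alpha$" and "from $p$ infer $!p$", and the axiom schemes $?(\alpha\to\beta)\to(?\alpha\to ?\beta)$, $!(p\to q)\to(!p\to !q)$,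 $\neg !0$, $?!p\to p$, $\alpha\to !?\alpha$. Abbreviations: $\Box p:= ?!p$ for propositions, $\nabla\alpha := !?\alpha$ for problems; $A\leftrightarrow B$ abbreviates $(A\to B)\land(B\to A)$ in the appropriate sort. A "principle" or schema is added to QHC as extra axioms (all instances of the indicated kind). Two (sets of) schemas are equivalent if each is derivable in QHC extended by the other. -}

module Defs where

open import Data.Nat using (ℕ; zero; suc)
open import Data.List using (List; []; _∷_)
open import Data.Product using (_×_; _,_)
open import Data.Sum using (_⊎_; inj₁; inj₂)

data Tm : Set where
  var : ℕ → Tm
  fn  : ℕ → List Tm → Tm

mutual
  subT : (ℕ → Tm) → Tm → Tm
  subT σ (var n)   = σ n
  subT σ (fn f ts) = fn f (subTs σ ts)

  subTs : (ℕ → Tm) → List Tm → List Tm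
  subTs σ []       = []
  subTs σ (t ∷ ts) = subT σ t ∷ subTs σ ts

liftσ : (ℕ → Tm) → ℕ → Tm
liftσ σ zero    = var zero
liftσ σ (suc n) = subT (λ m → var (suc m)) (σ n)

-- Formulas of QHC: propositions (Pr) and problems (Pb)
-- Quantifiers bind de Bruijn variable 0.

infixr 6 _∧ᵖ_ _∧ᵃ_
infixr 5 _∨ᵖ_ _∨ᵃ_
infixr 4 _⇒ᵖ_ _⇒ᵃ_

mutual
  data Pr : Set where
    patom : ℕ → List Tm → Pr
    ¿_    : Pb → Pr
    _∧ᵖ_ _∨ᵖ_ _⇒ᵖ_ : Pr → Pr → Pr
    ¬ᵖ_   : Pr → Pr
    𝟘     : Pr
    ∀ᵖ ∃ᵖ : Pr → Pr

  data Pb : Set where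
    aatom : ℕ → List Tm → Pb
    ‼_    : Pr → Pb
    _∧ᵃ_ _∨ᵃ_ _⇒ᵃ_ : Pb → Pb → Pb
    ¬ᵃ_   : Pb → Pb
    ⊥ᵃ    : Pb
    ∀ᵃ ∃ᵃ : Pb → Pb

mutual
  subPr : (ℕ → Tm) → Pr → Pr
  subPr σ (patom P ts) = patom P (subTs σ ts)
  subPr σ (¿ α)    = ¿ subPb σ α
  subPr σ (p ∧ᵖ q) = subPr σ p ∧ᵖ subPr σ q
  subPr σ (p ∨ᵖ q) = subPr σ p ∨ᵖ subPr σ q
  subPr σ (p ⇒ᵖ q) = subPr σ p ⇒ᵖ subPr σ q
  subPr σ (¬ᵖ p)   = ¬ᵖ subPr σ p
  subPr σ 𝟘        = 𝟘
  subPr σ (∀ᵖ p)   = ∀ᵖ (subPr (liftσ σ) p)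
  subPr σ (∃ᵖ p)   = ∃ᵖ (subPr (liftσ σ) p)

  subPb : (ℕ → Tm) → Pb → Pb
  subPb σ (aatom A ts) = aatom A (subTs σ ts)
  subPb σ (‼ p)    = ‼ subPr σ p
  subPb σ (α ∧ᵃ β) = subPb σ α ∧ᵃ subPb σ β
  subPb σ (α ∨ᵃ β) = subPb σ α ∨ᵃ subPb σ β
  subPb σ (α ⇒ᵃ β) = subPb σ α ⇒ᵃ subPb σ β
  subPb σ (¬ᵃ α)   = ¬ᵃ subPb σ α
  subPb σ ⊥ᵃ       = ⊥ᵃ
  subPb σ (∀ᵃ α)   = ∀ᵃ (subPb (liftσ σ) α)
  subPb σ (∃ᵃ α)   = ∃ᵃ (subPb (liftσ σ) α)

shift : ℕ → Tm
shift n = var (suc n)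

wkPr : Pr → Pr
wkPr = subPr shift

wkPb : Pb → Pb
wkPb = subPb shift

inst : Tm → ℕ → Tm
inst t zero    = t
inst t (suc n) = var n

_[_]ᵖ : Pr → Tm → Pr
p [ t ]ᵖ = subPr (inst t) p

_[_]ᵃ : Pb → Tm → Pb
α [ t ]ᵃ = subPb (inst t) α

□_ : Pr → Pr
□ p = ¿ (‼ p)

∇_ : Pb → Pb
∇ α = ‼ (¿ α)

_⇔ᵖ_ : Pr → Pr → Pr
p ⇔ᵖ q = (p ⇒ᵖ q) ∧ᵖ (q ⇒ᵖ p)

_⇔ᵃ_ : Pb → Pb → Pb
α ⇔ᵃ β = (α ⇒ᵃ β) ∧ᵃ (β ⇒ᵃ α)

data Fm : Set where
  prop : Pr → Fm
  prob : Pb → Fm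

Schema : Set₁
Schema = Fm → Set

infix 2 _⊢_

data _⊢_ (Γ : Schema) : Fm → Set where
  ax      : ∀ {φ} → Γ φ → Γ ⊢ φ

  pK      : ∀ {p q} → Γ ⊢ prop (p ⇒ᵖ (q ⇒ᵖ p))
  pS      : ∀ {p q r} → Γ ⊢ prop ((p ⇒ᵖ (q ⇒ᵖ r)) ⇒ᵖ ((p ⇒ᵖ q) ⇒ᵖ (p ⇒ᵖ r)))
  p∧I     : ∀ {p q} → Γ ⊢ prop (p ⇒ᵖ (q ⇒ᵖ (p ∧ᵖ q)))
  p∧E₁    : ∀ {p q} → Γ ⊢ prop ((p ∧ᵖ q) ⇒ᵖ p)
  p∧E₂    : ∀ {p q} → Γ ⊢ prop ((p ∧ᵖ q) ⇒ᵖ q)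
  p∨I₁    : ∀ {p q} → Γ ⊢ prop (p ⇒ᵖ (p ∨ᵖ q))
  p∨I₂    : ∀ {p q} → Γ ⊢ prop (q ⇒ᵖ (p ∨ᵖ q))
  p∨E     : ∀ {p q r} → Γ ⊢ prop ((p ⇒ᵖ r) ⇒ᵖ ((q ⇒ᵖ r) ⇒ᵖ ((p ∨ᵖ q) ⇒ᵖ r)))
  p𝟘E     : ∀ {p} → Γ ⊢ prop (𝟘 ⇒ᵖ p)
  p¬E     : ∀ {p} → Γ ⊢ prop ((¬ᵖ p) ⇒ᵖ (p ⇒ᵖ 𝟘))
  p¬I     : ∀ {p} → Γ ⊢ prop ((p ⇒ᵖ 𝟘) ⇒ᵖ (¬ᵖ p))
  pDNE    : ∀ {p} → Γ ⊢ prop (((p ⇒ᵖ 𝟘) ⇒ᵖ 𝟘) ⇒ᵖ p)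
  pMP     : ∀ {p q} → Γ ⊢ prop (p ⇒ᵖ q) → Γ ⊢ prop p → Γ ⊢ prop q
  p∀E     : ∀ {p} (t : Tm) → Γ ⊢ prop ((∀ᵖ p) ⇒ᵖ (p [ t ]ᵖ))
  p∃I     : ∀ {p} (t : Tm) → Γ ⊢ prop ((p [ t ]ᵖ) ⇒ᵖ (∃ᵖ p))
  p∀I     : ∀ {p q} → Γ ⊢ prop (wkPr q ⇒ᵖ p) → Γ ⊢ prop (q ⇒ᵖ ∀ᵖ p)
  p∃E     : ∀ {p q} → Γ ⊢ prop (p ⇒ᵖ wkPr q) → Γ ⊢ prop (∃ᵖ p ⇒ᵖ q)
  pGen    : ∀ {p} → Γ ⊢ prop p → Γ ⊢ prop (∀ᵖ p)

  aK      : ∀ {α β} → Γ ⊢ prob (α ⇒ᵃ (β ⇒ᵃ α))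
  aS      : ∀ {α β γ} → Γ ⊢ prob ((α ⇒ᵃ (β ⇒ᵃ γ)) ⇒ᵃ ((α ⇒ᵃ β) ⇒ᵃ (α ⇒ᵃ γ)))
  a∧I     : ∀ {α β} → Γ ⊢ prob (α ⇒ᵃ (β ⇒ᵃ (α ∧ᵃ β)))
  a∧E₁    : ∀ {α β} → Γ ⊢ prob ((α ∧ᵃ β) ⇒ᵃ α)
  a∧E₂    : ∀ {α β} → Γ ⊢ prob ((α ∧ᵃ β) ⇒ᵃ β)
  a∨I₁    : ∀ {α β} → Γ ⊢ prob (α ⇒ᵃ (α ∨ᵃ β))
  a∨I₂    : ∀ {α β} → Γ ⊢ prob (β ⇒ᵃ (α ∨ᵃ β))
  a∨E     : ∀ {α β γ} → Γ ⊢ prob ((α ⇒ᵃ γ) ⇒ᵃ ((β ⇒ᵃ γ) ⇒ᵃ ((α ∨ᵃ β) ⇒ᵃ γ)))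
  a⊥E     : ∀ {α} → Γ ⊢ prob (⊥ᵃ ⇒ᵃ α)
  a¬E     : ∀ {α} → Γ ⊢ prob ((¬ᵃ α) ⇒ᵃ (α ⇒ᵃ ⊥ᵃ))
  a¬I     : ∀ {α} → Γ ⊢ prob ((α ⇒ᵃ ⊥ᵃ) ⇒ᵃ (¬ᵃ α))
  aMP     : ∀ {α β} → Γ ⊢ prob (α ⇒ᵃ β) → Γ ⊢ prob α → Γ ⊢ prob β
  a∀E     : ∀ {α} (t : Tm) → Γ ⊢ prob ((∀ᵃ α) ⇒ᵃ (α [ t ]ᵃ))
  a∃I     : ∀ {α} (t : Tm) → Γ ⊢ prob ((α [ t ]ᵃ) ⇒ᵃ (∃ᵃ α))
  a∀I     : ∀ {α β} → Γ ⊢ prob (wkPb β ⇒ᵃ α) → Γ ⊢ prob (β ⇒ᵃ ∀ᵃ α)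
  a∃E     : ∀ {α β} → Γ ⊢ prob (α ⇒ᵃ wkPb β) → Γ ⊢ prob (∃ᵃ α ⇒ᵃ β)
  aGen    : ∀ {α} → Γ ⊢ prob α → Γ ⊢ prob (∀ᵃ α)

  ¿R      : ∀ {α} → Γ ⊢ prob α → Γ ⊢ prop (¿ α)
  ‼R      : ∀ {p} → Γ ⊢ prop p → Γ ⊢ prob (‼ p)
  ¿K      : ∀ {α β} → Γ ⊢ prop ((¿ (α ⇒ᵃ β)) ⇒ᵖ ((¿ α) ⇒ᵖ (¿ β)))
  ‼K      : ∀ {p q} → Γ ⊢ prob ((‼ (p ⇒ᵖ q)) ⇒ᵃ ((‼ p) ⇒ᵃ (‼ q)))
  ‼𝟘      : Γ ⊢ prob (¬ᵃ (‼ 𝟘))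
  ¿‼E     : ∀ {p} → Γ ⊢ prop ((¿ (‼ p)) ⇒ᵖ p)
  ‼¿I     : ∀ {α} → Γ ⊢ prob (α ⇒ᵃ (‼ (¿ α)))

_∪_ : Schema → Schema → Schema
(S ∪ T) φ = S φ ⊎ T φ

_▷_ : Schema → Schema → Set
S ▷ T = ∀ φ → T φ → S ⊢ φ

_≣_ : Schema → Schema → Set
S ≣ T = (S ▷ T) × (T ▷ S)

data ¿Star : Schema where
  inst¿* : ∀ α β → ¿Star (prop (((¿ α) ⇒ᵖ (¿ β)) ⇔ᵖ (¿ ((∇ α) ⇒ᵃ (∇ β)))))

data ∀Star : Schema where
  inst∀* : ∀ α → ∀Star (prop ((∀ᵖ (¿ α)) ⇔ᵖ (¿ (∀ᵃ (∇ α)))))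

data ∨Star : Schema where
  inst∨* : ∀ p q → ∨Star (prob (((‼ p) ∨ᵃ (‼ q)) ⇔ᵃ (‼ ((□ p) ∨ᵖ (□ q)))))

data ∃Star : Schema where
  inst∃* : ∀ p → ∃Star (prob ((∃ᵃ (‼ p)) ⇔ᵃ (‼ (∃ᵖ (□ p)))))

data AtomBox : Schema where
  instAB : ∀ P ts → AtomBox (prop ((patom P ts) ⇔ᵖ (□ (patom P ts))))

data AllBox : Schema where
  instB : ∀ p → AllBox (prop (p ⇔ᵖ (□ p)))

data AtomNabla : Schema where
  instAN : ∀ A ts → AtomNabla (prob ((aatom A ts) ⇔ᵃ (∇ (aatom A ts))))

data AllNabla : Schema where
  instN : ∀ α → AllNabla (prob (α ⇔ᵃ (∇ α)))

-- Both halves say that every formula is stable: p ⇒ □p for propositions, ∇α ⇒ α for problems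
-- (the converses are the axioms ?!p → p and α → !?α). Over QHC alone □ already distributes over ∧, ∨ and ∃, and ∇ over ∧, ∀ and ⇒ (for ∇⊥ ⇒ ⊥
-- use ¬!0); the ?*- and ∀*-principles supply exactly the missing cases ⇒ and ∀ for □, and the
-- ∨*- and ∃*-principles the missing cases ∨ and ∃ for ∇, while ¬ is implication into 0 or ⊥.
-- Conversely, one half of each principle holds in QHC and the other is stability of its left side.

module Submission where

open import Defs
open import Data.Nat using (ℕ; zero; suc)
open import Data.List using ([]; _∷_)
open import Data.Product using (_×_; _,_)
open import Data.Sum using (inj₁; inj₂)
open import Relation.Binary.PropositionalEquality
  using (_≡_; _≗_; refl; cong; cong₂; sym; subst; module ≡-Reasoning)

infixr 9 _∘ˢ_

_∘ˢ_ : (ℕ → Tm) → (ℕ → Tm) → ℕ → Tm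
(σ ∘ˢ τ) n = subT σ (τ n)

mutual
  subT-∘ : ∀ σ τ t → subT σ (subT τ t) ≡ subT (σ ∘ˢ τ) t
  subT-∘ σ τ (var n)   = refl
  subT-∘ σ τ (fn f ts) = cong (fn f) (subTs-∘ σ τ ts)

  subTs-∘ : ∀ σ τ ts → subTs σ (subTs τ ts) ≡ subTs (σ ∘ˢ τ) ts
  subTs-∘ σ τ []       = refl
  subTs-∘ σ τ (t ∷ ts) = cong₂ _∷_ (subT-∘ σ τ t) (subTs-∘ σ τ ts)

mutual
  subT-cancel : ∀ {σ τ} → σ ∘ˢ τ ≗ var → ∀ t → subT σ (subT τ t) ≡ t
  subT-cancel h (var n)   = h n
  subT-cancel h (fn f ts) = cong (fn f) (subTs-cancel h ts)

  subTs-cancel : ∀ {σ τ} → σ ∘ˢ τ ≗ var → ∀ ts → subTs σ (subTs τ ts) ≡ ts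
  subTs-cancel h []       = refl
  subTs-cancel h (t ∷ ts) = cong₂ _∷_ (subT-cancel h t) (subTs-cancel h ts)

liftσ-cancel : ∀ {σ τ} → σ ∘ˢ τ ≗ var → liftσ σ ∘ˢ liftσ τ ≗ var
liftσ-cancel h zero = refl
liftσ-cancel {σ} {τ} h (suc n) = begin
  subT (liftσ σ) (subT shift (τ n))  ≡⟨ subT-∘ (liftσ σ) shift (τ n) ⟩
  subT (shift ∘ˢ σ) (τ n)            ≡⟨ sym (subT-∘ shift σ (τ n)) ⟩
  subT shift (subT σ (τ n))          ≡⟨ cong (subT shift) (h n) ⟩
  var (suc n)                        ∎
  where open ≡-Reasoning

mutual
  subPr-cancel : ∀ {σ τ} → σ ∘ˢ τ ≗ var → ∀ p → subPr σ (subPr τ p) ≡ p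
  subPr-cancel h (patom P ts) = cong (patom P) (subTs-cancel h ts)
  subPr-cancel h (¿ α)    = cong ¿_ (subPb-cancel h α)
  subPr-cancel h (p ∧ᵖ q) = cong₂ _∧ᵖ_ (subPr-cancel h p) (subPr-cancel h q)
  subPr-cancel h (p ∨ᵖ q) = cong₂ _∨ᵖ_ (subPr-cancel h p) (subPr-cancel h q)
  subPr-cancel h (p ⇒ᵖ q) = cong₂ _⇒ᵖ_ (subPr-cancel h p) (subPr-cancel h q)
  subPr-cancel h (¬ᵖ p)   = cong ¬ᵖ_ (subPr-cancel h p)
  subPr-cancel h 𝟘        = refl
  subPr-cancel h (∀ᵖ p)   = cong ∀ᵖ (subPr-cancel (liftσ-cancel h) p)
  subPr-cancel h (∃ᵖ p)   = cong ∃ᵖ (subPr-cancel (liftσ-cancel h) p)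

  subPb-cancel : ∀ {σ τ} → σ ∘ˢ τ ≗ var → ∀ α → subPb σ (subPb τ α) ≡ α
  subPb-cancel h (aatom A ts) = cong (aatom A) (subTs-cancel h ts)
  subPb-cancel h (‼ p)    = cong ‼_ (subPr-cancel h p)
  subPb-cancel h (α ∧ᵃ β) = cong₂ _∧ᵃ_ (subPb-cancel h α) (subPb-cancel h β)
  subPb-cancel h (α ∨ᵃ β) = cong₂ _∨ᵃ_ (subPb-cancel h α) (subPb-cancel h β)
  subPb-cancel h (α ⇒ᵃ β) = cong₂ _⇒ᵃ_ (subPb-cancel h α) (subPb-cancel h β)
  subPb-cancel h (¬ᵃ α)   = cong ¬ᵃ_ (subPb-cancel h α)
  subPb-cancel h ⊥ᵃ       = refl
  subPb-cancel h (∀ᵃ α)   = cong ∀ᵃ (subPb-cancel (liftσ-cancel h) α)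
  subPb-cancel h (∃ᵃ α)   = cong ∃ᵃ (subPb-cancel (liftσ-cancel h) α)

inst₀∘liftσ-shift : inst (var 0) ∘ˢ liftσ shift ≗ var
inst₀∘liftσ-shift zero    = refl
inst₀∘liftσ-shift (suc n) = refl

-- subPr (liftσ shift) p is the body of wkPr (∀ᵖ p).
liftσ-shift-[var₀]ᵖ : ∀ p → subPr (liftσ shift) p [ var 0 ]ᵖ ≡ p
liftσ-shift-[var₀]ᵖ = subPr-cancel inst₀∘liftσ-shift

liftσ-shift-[var₀]ᵃ : ∀ α → subPb (liftσ shift) α [ var 0 ]ᵃ ≡ α
liftσ-shift-[var₀]ᵃ = subPb-cancel inst₀∘liftσ-shift

module HilbertRules
  {F : Set} (⊢_ : F → Set) (_⇒_ _∧_ _∨_ : F → F → F)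
  (K   : ∀ {a b} → ⊢ (a ⇒ (b ⇒ a)))
  (S   : ∀ {a b c} → ⊢ ((a ⇒ (b ⇒ c)) ⇒ ((a ⇒ b) ⇒ (a ⇒ c))))
  (mp  : ∀ {a b} → ⊢ (a ⇒ b) → ⊢ a → ⊢ b)
  (∧I  : ∀ {a b} → ⊢ (a ⇒ (b ⇒ (a ∧ b))))
  (∧E₁ : ∀ {a b} → ⊢ ((a ∧ b) ⇒ a))
  (∧E₂ : ∀ {a b} → ⊢ ((a ∧ b) ⇒ b))
  (∨E  : ∀ {a b c} → ⊢ ((a ⇒ c) ⇒ ((b ⇒ c) ⇒ ((a ∨ b) ⇒ c))))
  where

  private variable a a′ b b′ c r : F

  mp-under : ⊢ (r ⇒ (a ⇒ b)) → ⊢ (r ⇒ a) → ⊢ (r ⇒ b)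
  mp-under h₁ h₂ = mp (mp S h₁) h₂

  ⇒-const : ⊢ b → ⊢ (a ⇒ b)
  ⇒-const = mp K

  ⇒-trans : ⊢ (a ⇒ b) → ⊢ (b ⇒ c) → ⊢ (a ⇒ c)
  ⇒-trans h₁ h₂ = mp-under (⇒-const h₂) h₁

  ⇒-mono : ⊢ (a′ ⇒ a) → ⊢ (b ⇒ b′) → ⊢ ((a ⇒ b) ⇒ (a′ ⇒ b′))
  ⇒-mono {a′} h₁ h₂ =
    ⇒-trans (mp S (⇒-const h₂)) (mp-under (⇒-trans (K {b = a′}) S) (⇒-const h₁))

  ∧-intro : ⊢ (r ⇒ a) → ⊢ (r ⇒ b) → ⊢ (r ⇒ (a ∧ b))
  ∧-intro h₁ h₂ = mp-under (mp-under (⇒-const ∧I) h₁) h₂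

  ∨-elim : ⊢ (a ⇒ c) → ⊢ (b ⇒ c) → ⊢ ((a ∨ b) ⇒ c)
  ∨-elim h₁ h₂ = mp (mp ∨E h₁) h₂

  ⇔-intro : ⊢ (a ⇒ b) → ⊢ (b ⇒ a) → ⊢ ((a ⇒ b) ∧ (b ⇒ a))
  ⇔-intro h₁ h₂ = mp (mp ∧I h₁) h₂

  ⇔-to : ⊢ ((a ⇒ b) ∧ (b ⇒ a)) → ⊢ (a ⇒ b)
  ⇔-to = mp ∧E₁

  ⇔-from : ⊢ ((a ⇒ b) ∧ (b ⇒ a)) → ⊢ (b ⇒ a)
  ⇔-from = mp ∧E₂

module _ {Γ : Schema} where

  open HilbertRules (λ p → Γ ⊢ prop p) _⇒ᵖ_ _∧ᵖ_ _∨ᵖ_ pK pS pMP p∧I p∧E₁ p∧E₂ p∨E public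
    using ()
    renaming ( mp-under to mp-underᵖ; ⇒-trans to ⇒ᵖ-trans; ⇒-const to ⇒ᵖ-const
             ; ⇒-mono to ⇒ᵖ-mono; ∨-elim to ∨ᵖ-elim
             ; ⇔-intro to ⇔ᵖ-intro; ⇔-to to ⇔ᵖ-to; ⇔-from to ⇔ᵖ-from )

  open HilbertRules (λ α → Γ ⊢ prob α) _⇒ᵃ_ _∧ᵃ_ _∨ᵃ_ aK aS aMP a∧I a∧E₁ a∧E₂ a∨E public
    using ()
    renaming ( ⇒-trans to ⇒ᵃ-trans; ⇒-mono to ⇒ᵃ-mono; ∧-intro to ∧ᵃ-intro; ∨-elim to ∨ᵃ-elim
             ; ⇔-intro to ⇔ᵃ-intro; ⇔-to to ⇔ᵃ-to; ⇔-from to ⇔ᵃ-from )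

module _ {Γ : Schema} where

  ¿-mono : ∀ {α β} → Γ ⊢ prob (α ⇒ᵃ β) → Γ ⊢ prop (¿ α ⇒ᵖ ¿ β)
  ¿-mono h = pMP ¿K (¿R h)

  ‼-mono : ∀ {p q} → Γ ⊢ prop (p ⇒ᵖ q) → Γ ⊢ prob (‼ p ⇒ᵃ ‼ q)
  ‼-mono h = aMP ‼K (‼R h)

  □-mono : ∀ {p q} → Γ ⊢ prop (p ⇒ᵖ q) → Γ ⊢ prop (□ p ⇒ᵖ □ q)
  □-mono h = ¿-mono (‼-mono h)

  ∇-mono : ∀ {α β} → Γ ⊢ prob (α ⇒ᵃ β) → Γ ⊢ prob (∇ α ⇒ᵃ ∇ β)
  ∇-mono h = ‼-mono (¿-mono h)

  ∀ᵖ-elim₀ : ∀ {p} → Γ ⊢ prop (∀ᵖ (subPr (liftσ shift) p) ⇒ᵖ p)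
  ∀ᵖ-elim₀ {p} = subst (λ q → Γ ⊢ prop (∀ᵖ (subPr (liftσ shift) p) ⇒ᵖ q))
                       (liftσ-shift-[var₀]ᵖ p) (p∀E (var 0))

  ∃ᵖ-intro₀ : ∀ {p} → Γ ⊢ prop (p ⇒ᵖ ∃ᵖ (subPr (liftσ shift) p))
  ∃ᵖ-intro₀ {p} = subst (λ q → Γ ⊢ prop (q ⇒ᵖ ∃ᵖ (subPr (liftσ shift) p)))
                        (liftσ-shift-[var₀]ᵖ p) (p∃I (var 0))

  ∀ᵃ-elim₀ : ∀ {α} → Γ ⊢ prob (∀ᵃ (subPb (liftσ shift) α) ⇒ᵃ α)
  ∀ᵃ-elim₀ {α} = subst (λ β → Γ ⊢ prob (∀ᵃ (subPb (liftσ shift) α) ⇒ᵃ β))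
                       (liftσ-shift-[var₀]ᵃ α) (a∀E (var 0))

  ∃ᵃ-intro₀ : ∀ {α} → Γ ⊢ prob (α ⇒ᵃ ∃ᵃ (subPb (liftσ shift) α))
  ∃ᵃ-intro₀ {α} = subst (λ β → Γ ⊢ prob (β ⇒ᵃ ∃ᵃ (subPb (liftσ shift) α)))
                        (liftσ-shift-[var₀]ᵃ α) (a∃I (var 0))

  ∀ᵖ-mono : ∀ {p q} → Γ ⊢ prop (p ⇒ᵖ q) → Γ ⊢ prop (∀ᵖ p ⇒ᵖ ∀ᵖ q)
  ∀ᵖ-mono h = p∀I (⇒ᵖ-trans ∀ᵖ-elim₀ h)

  ∃ᵃ-mono : ∀ {α β} → Γ ⊢ prob (α ⇒ᵃ β) → Γ ⊢ prob (∃ᵃ α ⇒ᵃ ∃ᵃ β)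
  ∃ᵃ-mono h = a∃E (⇒ᵃ-trans h ∃ᵃ-intro₀)

module _ {Γ : Schema} where

  -- ?* moves □ inside the implication, and ?γ ⇒ □?γ holds for every problem γ.
  ⇒□-closed-⇒ᵖ : ∀ {p q} →
    Γ ⊢ prop ((□ p ⇒ᵖ □ q) ⇒ᵖ ¿ (∇ (‼ p) ⇒ᵃ ∇ (‼ q))) →
    Γ ⊢ prop (p ⇒ᵖ □ p) → Γ ⊢ prop (q ⇒ᵖ □ q) → Γ ⊢ prop ((p ⇒ᵖ q) ⇒ᵖ □ (p ⇒ᵖ q))
  ⇒□-closed-⇒ᵖ {p} {q} ¿* p⇒□p q⇒□q =
    ⇒ᵖ-trans (⇒ᵖ-mono ¿‼E q⇒□q) (⇒ᵖ-trans ¿* (⇒ᵖ-trans (¿-mono ‼¿I) (□-mono unbox)))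
    where
    unbox : Γ ⊢ prop (¿ (∇ (‼ p) ⇒ᵃ ∇ (‼ q)) ⇒ᵖ (p ⇒ᵖ q))
    unbox = ⇒ᵖ-trans ¿K (⇒ᵖ-mono (⇒ᵖ-trans p⇒□p (¿-mono ‼¿I)) (⇒ᵖ-trans ¿‼E ¿‼E))

  ⇒□-closed-∀ᵖ : ∀ {p} →
    Γ ⊢ prop (∀ᵖ (□ p) ⇔ᵖ (¿ ∀ᵃ (∇ (‼ p)))) →
    Γ ⊢ prop (p ⇒ᵖ □ p) → Γ ⊢ prop (∀ᵖ p ⇒ᵖ □ (∀ᵖ p))
  ⇒□-closed-∀ᵖ ∀* p⇒□p =
    ⇒ᵖ-trans (∀ᵖ-mono p⇒□p) (⇒ᵖ-trans (⇔ᵖ-to ∀*)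
      (⇒ᵖ-trans (¿-mono ‼¿I) (□-mono (⇒ᵖ-trans (⇔ᵖ-from ∀*) (∀ᵖ-mono ¿‼E)))))

BoxPrinciples : Schema
BoxPrinciples = (¿Star ∪ ∀Star) ∪ AtomBox

¿*-□ : ∀ p q → BoxPrinciples ⊢ prop ((□ p ⇒ᵖ □ q) ⇒ᵖ ¿ (∇ (‼ p) ⇒ᵃ ∇ (‼ q)))
¿*-□ p q = ⇔ᵖ-to (ax (inj₁ (inj₁ (inst¿* (‼ p) (‼ q)))))

∀*-□ : ∀ p → BoxPrinciples ⊢ prop (∀ᵖ (□ p) ⇔ᵖ (¿ ∀ᵃ (∇ (‼ p))))
∀*-□ p = ax (inj₁ (inj₂ (inst∀* (‼ p))))

p⇒□p : ∀ p → BoxPrinciples ⊢ prop (p ⇒ᵖ □ p)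
p⇒□p (patom P ts) = ⇔ᵖ-to (ax (inj₂ (instAB P ts)))
p⇒□p (¿ α)        = ¿-mono ‼¿I
p⇒□p (p ∧ᵖ q)     = mp-underᵖ (mp-underᵖ (⇒ᵖ-const □∧) (⇒ᵖ-trans p∧E₁ (p⇒□p p)))
                                (⇒ᵖ-trans p∧E₂ (p⇒□p q))
  where
  □∧ : BoxPrinciples ⊢ prop (□ p ⇒ᵖ (□ q ⇒ᵖ □ (p ∧ᵖ q)))
  □∧ = ⇒ᵖ-trans (¿-mono (⇒ᵃ-trans (‼-mono p∧I) ‼K)) ¿K
p⇒□p (p ∨ᵖ q)     = ∨ᵖ-elim (⇒ᵖ-trans (p⇒□p p) (□-mono p∨I₁)) (⇒ᵖ-trans (p⇒□p q) (□-mono p∨I₂))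
p⇒□p (p ⇒ᵖ q)     = ⇒□-closed-⇒ᵖ (¿*-□ p q) (p⇒□p p) (p⇒□p q)
p⇒□p (¬ᵖ p)       = ⇒ᵖ-trans p¬E (⇒ᵖ-trans ¬p⇒□¬p (□-mono p¬I))
  where
  ¬p⇒□¬p : BoxPrinciples ⊢ prop ((p ⇒ᵖ 𝟘) ⇒ᵖ □ (p ⇒ᵖ 𝟘))
  ¬p⇒□¬p = ⇒□-closed-⇒ᵖ (¿*-□ p 𝟘) (p⇒□p p) p𝟘E
p⇒□p 𝟘            = p𝟘E
p⇒□p (∀ᵖ p)       = ⇒□-closed-∀ᵖ (∀*-□ p) (p⇒□p p)
p⇒□p (∃ᵖ p)       = p∃E (⇒ᵖ-trans (p⇒□p p) (□-mono ∃ᵖ-intro₀))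

BoxPrinciples▷AllBox : BoxPrinciples ▷ AllBox
BoxPrinciples▷AllBox _ (instB p) = ⇔ᵖ-intro (p⇒□p p) ¿‼E

AllBox▷BoxPrinciples : AllBox ▷ BoxPrinciples
AllBox▷BoxPrinciples _ (inj₁ (inj₁ (inst¿* α β))) =
  ⇔ᵖ-intro (⇒ᵖ-trans (⇔ᵖ-to (ax (instB (¿ α ⇒ᵖ ¿ β)))) (¿-mono ‼K))
           (⇒ᵖ-trans ¿K (⇒ᵖ-mono (¿-mono ‼¿I) ¿‼E))
AllBox▷BoxPrinciples _ (inj₁ (inj₂ (inst∀* α))) =
  ⇔ᵖ-intro (⇒ᵖ-trans (⇔ᵖ-to (ax (instB (∀ᵖ (¿ α))))) (¿-mono (a∀I (‼-mono ∀ᵖ-elim₀))))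
           (p∀I (⇒ᵖ-trans (¿-mono ∀ᵃ-elim₀) ¿‼E))
AllBox▷BoxPrinciples _ (inj₂ (instAB P ts)) = ax (instB (patom P ts))

module _ {Γ : Schema} where

  ∇⇒-closed-⇒ᵃ : ∀ {α β} → Γ ⊢ prob (∇ β ⇒ᵃ β) → Γ ⊢ prob (∇ (α ⇒ᵃ β) ⇒ᵃ (α ⇒ᵃ β))
  ∇⇒-closed-⇒ᵃ ∇β⇒β = ⇒ᵃ-trans (‼-mono ¿K) (⇒ᵃ-trans ‼K (⇒ᵃ-mono ‼¿I ∇β⇒β))

  ∇⇒-closed-∨ᵃ : ∀ {α β} →
    Γ ⊢ prob ((∇ α ∨ᵃ ∇ β) ⇔ᵃ (‼ (□ (¿ α) ∨ᵖ □ (¿ β)))) →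
    Γ ⊢ prob (∇ α ⇒ᵃ α) → Γ ⊢ prob (∇ β ⇒ᵃ β) → Γ ⊢ prob (∇ (α ∨ᵃ β) ⇒ᵃ (α ∨ᵃ β))
  ∇⇒-closed-∨ᵃ ∨* ∇α⇒α ∇β⇒β =
    ⇒ᵃ-trans (∇-mono (⇒ᵃ-trans (∨ᵃ-elim (⇒ᵃ-trans ‼¿I a∨I₁) (⇒ᵃ-trans ‼¿I a∨I₂)) (⇔ᵃ-to ∨*)))
      (⇒ᵃ-trans (‼-mono ¿‼E)
        (⇒ᵃ-trans (⇔ᵃ-from ∨*) (∨ᵃ-elim (⇒ᵃ-trans ∇α⇒α a∨I₁) (⇒ᵃ-trans ∇β⇒β a∨I₂))))

  ∇⇒-closed-∃ᵃ : ∀ {α} →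
    Γ ⊢ prob (∃ᵃ (∇ α) ⇔ᵃ (‼ ∃ᵖ (□ (¿ α)))) →
    Γ ⊢ prob (∇ α ⇒ᵃ α) → Γ ⊢ prob (∇ (∃ᵃ α) ⇒ᵃ ∃ᵃ α)
  ∇⇒-closed-∃ᵃ ∃* ∇α⇒α =
    ⇒ᵃ-trans (∇-mono (⇒ᵃ-trans (∃ᵃ-mono ‼¿I) (⇔ᵃ-to ∃*)))
      (⇒ᵃ-trans (‼-mono ¿‼E) (⇒ᵃ-trans (⇔ᵃ-from ∃*) (∃ᵃ-mono ∇α⇒α)))

NablaPrinciples : Schema
NablaPrinciples = (∨Star ∪ ∃Star) ∪ AtomNabla

∨*-¿ : ∀ α β → NablaPrinciples ⊢ prob ((∇ α ∨ᵃ ∇ β) ⇔ᵃ (‼ (□ (¿ α) ∨ᵖ □ (¿ β))))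
∨*-¿ α β = ax (inj₁ (inj₁ (inst∨* (¿ α) (¿ β))))

∃*-¿ : ∀ α → NablaPrinciples ⊢ prob (∃ᵃ (∇ α) ⇔ᵃ (‼ ∃ᵖ (□ (¿ α))))
∃*-¿ α = ax (inj₁ (inj₂ (inst∃* (¿ α))))

∇α⇒α : ∀ α → NablaPrinciples ⊢ prob (∇ α ⇒ᵃ α)
∇α⇒α (aatom A ts) = ⇔ᵃ-from (ax (inj₂ (instAN A ts)))
∇α⇒α (‼ p)        = ‼-mono ¿‼E
∇α⇒α (α ∧ᵃ β)     = ∧ᵃ-intro (⇒ᵃ-trans (∇-mono a∧E₁) (∇α⇒α α))
                             (⇒ᵃ-trans (∇-mono a∧E₂) (∇α⇒α β))
∇α⇒α (α ∨ᵃ β)     = ∇⇒-closed-∨ᵃ (∨*-¿ α β) (∇α⇒α α) (∇α⇒α β)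
∇α⇒α (α ⇒ᵃ β)     = ∇⇒-closed-⇒ᵃ (∇α⇒α β)
∇α⇒α (¬ᵃ α)       = ⇒ᵃ-trans (∇-mono a¬E) (⇒ᵃ-trans (∇⇒-closed-⇒ᵃ (∇α⇒α ⊥ᵃ)) a¬I)
∇α⇒α ⊥ᵃ           = ⇒ᵃ-trans (∇-mono a⊥E) (⇒ᵃ-trans (‼-mono ¿‼E) (aMP a¬E ‼𝟘))
∇α⇒α (∀ᵃ α)       = a∀I (⇒ᵃ-trans (∇-mono ∀ᵃ-elim₀) (∇α⇒α α))
∇α⇒α (∃ᵃ α)       = ∇⇒-closed-∃ᵃ (∃*-¿ α) (∇α⇒α α)

NablaPrinciples▷AllNabla : NablaPrinciples ▷ AllNabla
NablaPrinciples▷AllNabla _ (instN α) = ⇔ᵃ-intro ‼¿I (∇α⇒α α)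

AllNabla▷NablaPrinciples : AllNabla ▷ NablaPrinciples
AllNabla▷NablaPrinciples _ (inj₁ (inj₁ (inst∨* p q))) =
  ⇔ᵃ-intro (∨ᵃ-elim (⇒ᵃ-trans ‼¿I (‼-mono p∨I₁)) (⇒ᵃ-trans ‼¿I (‼-mono p∨I₂)))
           (⇒ᵃ-trans (‼-mono (∨ᵖ-elim (¿-mono a∨I₁) (¿-mono a∨I₂)))
                     (⇔ᵃ-from (ax (instN (‼ p ∨ᵃ ‼ q)))))
AllNabla▷NablaPrinciples _ (inj₁ (inj₂ (inst∃* p))) =
  ⇔ᵃ-intro (a∃E (⇒ᵃ-trans ‼¿I (‼-mono ∃ᵖ-intro₀)))
           (⇒ᵃ-trans (‼-mono (p∃E (¿-mono ∃ᵃ-intro₀))) (⇔ᵃ-from (ax (instN (∃ᵃ (‼ p))))))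
AllNabla▷NablaPrinciples _ (inj₂ (instAN A ts)) = ax (instN (aatom A ts))

mainTheorem4 : (((¿Star ∪ ∀Star) ∪ AtomBox) ≣ AllBox)
    × (((∨Star ∪ ∃Star) ∪ AtomNabla) ≣ AllNabla)
mainTheorem4 = (BoxPrinciples▷AllBox , AllBox▷BoxPrinciples)
             , (NablaPrinciples▷AllNabla , AllNabla▷NablaPrinciples)
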